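{- Under the hypotheses below, $\mathit{rb}\circ\mathit{ev}=\mathit{hy}$ as partial functions on $\lambda$-terms. Hypotheses: $\mathit{ev}$, $\mathit{rb}$, $\mathit{su}$, $\mathit{hy}$ are evaluators defined as in the context with parameters satisfying the stated provisos, and the equations $\mathit{la}_e=\mathit{la}_s$, $\mathit{ar}_{1e}=\mathit{ar}_{1s}$, $\mathit{ar}_{2e}=\mathit{ar}_{2s}$, $\mathit{la}_r\circ\mathit{la}_e=\mathit{la}_h$, $\mathit{ar}_{2r}\circ\mathit{ar}_{2e}=\mathit{ar}_{2h}$ hold, where both sides are compared after identifying $\mathit{ev}$ with $\mathit{su}$ and $\mathit{rb}\circ\mathit{ev}$ with $\mathit{hy}$ and simplifying compositions with $\mathrm{id}$.
   Context: Terms: $\Lambda ::= x\mid \lambda x.\Lambda\mid \Lambda\Lambda$ (modulo $\alpha$); $[N/x]B$ is capture-avoiding substitution. An evaluator is a partial function $\Lambda\rightharpoonup\Lambda$ (undefined = divergence); $\mathrm{id}$ is the identity; $(E_2\circ E_1)(M)=E_2(E_1(M))$, undefined if $E_1(M)$ is. Eval-apply template $\mathrm{EA}(\mathit{la},\mathit{op}_1,\mathit{ar}_1,\mathit{op}_2,\mathit{ar}_2)$: the least $E$ with $E(x)=x$; $E(\lambda x.B)=\lambda x.\mathit{la}(B)$; for $E(MN)$: compute $M'=\mathit{op}_1(M)$; if $M'\equiv\lambda x.B$, compute $N'=\mathit{ar}_1(N)$ and return $E([N'/x]B)$; otherwise compute $M''=\mathit{op}_2(M')$, then $N'=\mathit{ar}_2(N)$,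 and return $M''N'$ (in this order; divergence propagates). Readback template $\mathrm{RB}(\mathit{la},\mathit{ar}_2)$: the least $R$ with $R(x)=x$, $R(\lambda x.B)=\lambda x.\mathit{la}(B)$, $R(MN)=R(M)\,\mathit{ar}_2(N)$. Definitions and provisos: (1) $\mathit{ev}=\mathrm{EA}(\mathit{la}_e,\mathit{ev},\mathit{ar}_{1e},\mathrm{id},\mathit{ar}_{2e})$ with $\mathit{la}_e,\mathit{ar}_{1e},\mathit{ar}_{2e}\in\{\mathrm{id},\mathit{ev}\}$. (2) $\mathit{rb}=\mathrm{RB}(\mathit{la}_r,\mathit{ar}_{2r})$ where, for each pair $(\mathit{la}_r,\mathit{la}_e)$, $(\mathit{ar}_{2r},\mathit{ar}_{2e})$: if the eval parameter is $\mathrm{id}$ the readback parameter is one of $\mathrm{id},\mathit{ev},\mathit{rb}\circ\mathit{ev}$; if it is $\mathit{ev}$ the readback parameter is $\mathrm{id}$ or $\mathit{rb}$; at least one of $\mathit{la}_r,\mathit{ar}_{2r}$ is $\mathit{ev}$ or $\mathit{rb}\circ\mathit{ev}$ at a position whose eval parameter is $\mathrm{id}$, and at least one is $\mathit{rb}$ or $\mathit{rb}\circ\mathit{ev}$. (3) $\mathit{su}=\mathrm{EA}(\mathit{la}_s,\mathit{su},\mathit{ar}_{1s},\mathrm{id},\mathit{ar}_{2s})$ with $\mathit{la}_s,\mathit{ar}_{1s},\mathit{ar}_{2s}\in\{\mathrm{id},\mathit{su}\}$. (4) $\mathit{hy}=\mathrm{EA}(\mathit{la}_h,\mathit{su},\mathit{ar}_{1s},\mathit{hy},\mathit{ar}_{2h})$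 where, for each pair $(\mathit{la}_h,\mathit{la}_s)$, $(\mathit{ar}_{2h},\mathit{ar}_{2s})$: if the subsidiary parameter is $\mathrm{id}$ the hybrid parameter is one of $\mathrm{id},\mathit{su},\mathit{hy}$; if it is $\mathit{su}$ the hybrid parameter is $\mathit{su}$ or $\mathit{hy}$; at least one of $\mathit{la}_h,\mathit{ar}_{2h}$ is $\mathit{hy}$, and at least one is $\mathit{su}$ or $\mathit{hy}$ at a position whose subsidiary parameter is $\mathrm{id}$. -}

module Defs where

open import Data.Nat using (ℕ; zero; suc)
open import Data.Product using (_×_)
open import Data.Sum using (_⊎_)
open import Relation.Binary.PropositionalEquality using (_≡_)

-- λ-terms modulo α: de Bruijn indices (free variables are indices that
-- are not bound; open terms are allowed).

data Term : Set where
  var : ℕ → Term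
  lam : Term → Term
  app : Term → Term → Term

ext : (ℕ → ℕ) → ℕ → ℕ
ext ρ zero    = zero
ext ρ (suc n) = suc (ρ n)

rename : (ℕ → ℕ) → Term → Term
rename ρ (var x)   = var (ρ x)
rename ρ (lam B)   = lam (rename (ext ρ) B)
rename ρ (app M N) = app (rename ρ M) (rename ρ N)

exts : (ℕ → Term) → ℕ → Term
exts σ zero    = var zero
exts σ (suc n) = rename suc (σ n)

subst : (ℕ → Term) → Term → Term
subst σ (var x)   = σ x
subst σ (lam B)   = lam (subst (exts σ) B)
subst σ (app M N) = app (subst σ M) (subst σ N)

sub0 : Term → ℕ → Term
sub0 N zero    = N
sub0 N (suc n) = var n

-- B [ N ] : capture-avoiding substitution [N/x]B, where λx.B is lam B.
_[_] : Term → Term → Term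
B [ N ] = subst (sub0 N) B

data NonLam : Term → Set where
  nvar : ∀ {x} → NonLam (var x)
  napp : ∀ {M N} → NonLam (app M N)

-- Parameters.
-- Eval/subsidiary parameter: id or the evaluator itself.
data EP : Set where
  idP evP : EP

data RP : Set where
  idR evR rbevR rbR : RP

data HP : Set where
  idH suH hyH : HP

-- Partial functions as (graphs of) least fixed points: big-step
-- relations defined inductively.  E M N means "E(M) is defined and = N".

-- Eval-apply template instance EA(la, E, ar1, id, ar2), used for ev and su.
mutual
  data Ev (la a1 a2 : EP) : Term → Term → Set where
    evar : ∀ {x} → Ev la a1 a2 (var x) (var x)
    elam : ∀ {B B'} → EvP la a1 a2 la B B' → Ev la a1 a2 (lam B) (lam B')
    ebeta : ∀ {M N B N' R} → Ev la a1 a2 M (lam B) → EvP la a1 a2 a1 N N' →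
            Ev la a1 a2 (B [ N' ]) R → Ev la a1 a2 (app M N) R
    eapp : ∀ {M N M' N'} → Ev la a1 a2 M M' → NonLam M' →
           EvP la a1 a2 a2 N N' → Ev la a1 a2 (app M N) (app M' N')

  data EvP (la a1 a2 : EP) : EP → Term → Term → Set where
    pid : ∀ {M} → EvP la a1 a2 idP M M
    pev : ∀ {M N} → Ev la a1 a2 M N → EvP la a1 a2 evP M N

-- Readback template RB(la_r, ar2r) over ev = Ev la a1 a2.
mutual
  data Rb (la a1 a2 : EP) (lr ar : RP) : Term → Term → Set where
    rvar : ∀ {x} → Rb la a1 a2 lr ar (var x) (var x)
    rlam : ∀ {B B'} → RbP la a1 a2 lr ar lr B B' → Rb la a1 a2 lr ar (lam B) (lam B')
    rapp : ∀ {M N M' N'} → Rb la a1 a2 lr ar M M' → RbP la a1 a2 lr ar ar N N' →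
           Rb la a1 a2 lr ar (app M N) (app M' N')

  data RbP (la a1 a2 : EP) (lr ar : RP) : RP → Term → Term → Set where
    rid  : ∀ {M} → RbP la a1 a2 lr ar idR M M
    rev  : ∀ {M N} → Ev la a1 a2 M N → RbP la a1 a2 lr ar evR M N
    rrbev : ∀ {M P N} → Ev la a1 a2 M P → Rb la a1 a2 lr ar P N → RbP la a1 a2 lr ar rbevR M N
    rrb  : ∀ {M N} → Rb la a1 a2 lr ar M N → RbP la a1 a2 lr ar rbR M N

-- Hybrid: EA(la_h, su, ar1s, hy, ar2h) with su = Ev la a1 a2.
mutual
  data Hy (la a1 a2 : EP) (lh ah : HP) : Term → Term → Set where
    hvar : ∀ {x} → Hy la a1 a2 lh ah (var x) (var x)
    hlam : ∀ {B B'} → HyP la a1 a2 lh ah lh B B' → Hy la a1 a2 lh ah (lam B) (lam B')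
    hbeta : ∀ {M N B N' R} → Ev la a1 a2 M (lam B) → EvP la a1 a2 a1 N N' →
            Hy la a1 a2 lh ah (B [ N' ]) R → Hy la a1 a2 lh ah (app M N) R
    happ : ∀ {M N M' M'' N'} → Ev la a1 a2 M M' → NonLam M' →
           Hy la a1 a2 lh ah M' M'' → HyP la a1 a2 lh ah ah N N' →
           Hy la a1 a2 lh ah (app M N) (app M'' N')

  data HyP (la a1 a2 : EP) (lh ah : HP) : HP → Term → Term → Set where
    hid : ∀ {M} → HyP la a1 a2 lh ah idH M M
    hsu : ∀ {M N} → Ev la a1 a2 M N → HyP la a1 a2 lh ah suH M N
    hhy : ∀ {M N} → Hy la a1 a2 lh ah M N → HyP la a1 a2 lh ah hyH M N

-- (2) admissible readback parameter given the corresponding eval parameter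
data RAdm : EP → RP → Set where
  i-id   : RAdm idP idR
  i-ev   : RAdm idP evR
  i-rbev : RAdm idP rbevR
  e-id   : RAdm evP idR
  e-rb   : RAdm evP rbR

data EvIsh : RP → Set where
  ei-ev   : EvIsh evR
  ei-rbev : EvIsh rbevR

data RbIsh : RP → Set where
  ri-rb   : RbIsh rbR
  ri-rbev : RbIsh rbevR

RbProviso : (lae ar2e : EP) (lar ar2r : RP) → Set
RbProviso lae ar2e lar ar2r =
  RAdm lae lar × RAdm ar2e ar2r ×
  ((EvIsh lar × lae ≡ idP) ⊎ (EvIsh ar2r × ar2e ≡ idP)) ×
  (RbIsh lar ⊎ RbIsh ar2r)

-- (4) admissible hybrid parameter given the corresponding subsidiary parameter
data HAdm : EP → HP → Set where
  i-id : HAdm idP idH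
  i-su : HAdm idP suH
  i-hy : HAdm idP hyH
  s-su : HAdm evP suH
  s-hy : HAdm evP hyH

data SuIsh : HP → Set where
  si-su : SuIsh suH
  si-hy : SuIsh hyH

HyProviso : (las ar2s : EP) (lah ar2h : HP) → Set
HyProviso las ar2s lah ar2h =
  HAdm las lah × HAdm ar2s ar2h ×
  (lah ≡ hyH ⊎ ar2h ≡ hyH) ×
  ((SuIsh lah × las ≡ idP) ⊎ (SuIsh ar2h × ar2s ≡ idP))

-- The equation  r ∘ e = h  after identifying ev with su and rb∘ev with hy
-- and simplifying compositions with id.  Only these cases simplify to a
-- hybrid parameter.
data CompEq : RP → EP → HP → Set where
  c-id-id   : CompEq idR   idP idH
  c-ev-id   : CompEq evR   idP suH   -- ev ∘ id = ev = su
  c-rbev-id : CompEq rbevR idP hyH   -- (rb∘ev) ∘ id = rb∘ev = hy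
  c-id-ev   : CompEq idR   evP suH   -- id ∘ ev = ev = su
  c-rb-ev   : CompEq rbR   evP hyH   -- rb ∘ ev = hy

-- The derivations of rb ∘ ev and of hy correspond rule by rule, each CompEq case
-- matching an interpretation r ∘ e of a parameter with the hybrid parameter h.
-- The one non-local case is a neutral application: hy applies hy = rb ∘ ev to the
-- operator value M', whereas rb ∘ ev reads M' back directly.  The two agree because
-- ev is idempotent and deterministic, so ev M' = M'.  The provisos on the
-- parameters only make the evaluators meaningful; the correspondence holds without them.
module Submission where

open import Defs
open import Data.Product using (Σ; _×_; _,_)
open import Function.Bundles using (_⇔_; mk⇔)
open import Relation.Binary.PropositionalEquality using (_≡_; refl)

module _ {la a1 a2 : EP} where

  mutual
    Ev-idempotent : ∀ {M P} → Ev la a1 a2 M P → Ev la a1 a2 P P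
    Ev-idempotent evar           = evar
    Ev-idempotent (elam p)       = elam (EvP-idempotent p)
    Ev-idempotent (ebeta _ _ e)  = Ev-idempotent e
    Ev-idempotent (eapp e nl p)  = eapp (Ev-idempotent e) nl (EvP-idempotent p)

    EvP-idempotent : ∀ {x M P} → EvP la a1 a2 x M P → EvP la a1 a2 x P P
    EvP-idempotent pid     = pid
    EvP-idempotent (pev e) = pev (Ev-idempotent e)

  mutual
    Ev-deterministic : ∀ {M P Q} → Ev la a1 a2 M P → Ev la a1 a2 M Q → P ≡ Q
    Ev-deterministic evar evar = refl
    Ev-deterministic (elam p) (elam q) with EvP-deterministic p q
    ... | refl = refl
    Ev-deterministic (ebeta e p e′) (ebeta f q f′)
      with Ev-deterministic e f | EvP-deterministic p q
    ... | refl | refl = Ev-deterministic e′ f′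
    Ev-deterministic (ebeta e _ _) (eapp f nl _) with Ev-deterministic e f
    Ev-deterministic (ebeta e _ _) (eapp f () _) | refl
    Ev-deterministic (eapp e nl _) (ebeta f _ _) with Ev-deterministic e f
    Ev-deterministic (eapp e () _) (ebeta f _ _) | refl
    Ev-deterministic (eapp e _ p) (eapp f _ q)
      with Ev-deterministic e f | EvP-deterministic p q
    ... | refl | refl = refl

    EvP-deterministic : ∀ {x M P Q} → EvP la a1 a2 x M P → EvP la a1 a2 x M Q → P ≡ Q
    EvP-deterministic pid     pid     = refl
    EvP-deterministic (pev e) (pev f) = Ev-deterministic e f

  Ev-result-fixed : ∀ {M P Q} → Ev la a1 a2 M P → Ev la a1 a2 P Q → P ≡ Q
  Ev-result-fixed e = Ev-deterministic (Ev-idempotent e)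

module _ {la a1 a2 : EP} {lr ar : RP} where

  RbAfterEv : Term → Term → Set
  RbAfterEv M N = Σ Term (λ P → Ev la a1 a2 M P × Rb la a1 a2 lr ar P N)

  RbPAfterEvP : RP → EP → Term → Term → Set
  RbPAfterEvP r x M N = Σ Term (λ P → EvP la a1 a2 x M P × RbP la a1 a2 lr ar r P N)

  module _ {lh ah : HP} (la-eq : CompEq lr la lh) (ar-eq : CompEq ar a2 ah) where

    mutual
      RbAfterEv⇒Hy : ∀ {M P N} → Ev la a1 a2 M P → Rb la a1 a2 lr ar P N →
                     Hy la a1 a2 lh ah M N
      RbAfterEv⇒Hy (ebeta e p e′) r         = hbeta e p (RbAfterEv⇒Hy e′ r)
      RbAfterEv⇒Hy evar           rvar      = hvar
      RbAfterEv⇒Hy (elam p)       (rlam q)  = hlam (RbPAfterEvP⇒HyP la-eq p q)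
      RbAfterEv⇒Hy (eapp e nl p)  (rapp r q) =
        happ e nl (RbAfterEv⇒Hy (Ev-idempotent e) r) (RbPAfterEvP⇒HyP ar-eq p q)

      RbPAfterEvP⇒HyP : ∀ {r x h M P N} → CompEq r x h → EvP la a1 a2 x M P →
                        RbP la a1 a2 lr ar r P N → HyP la a1 a2 lh ah h M N
      RbPAfterEvP⇒HyP c-id-id   pid     rid         = hid
      RbPAfterEvP⇒HyP c-ev-id   pid     (rev e)     = hsu e
      RbPAfterEvP⇒HyP c-rbev-id pid     (rrbev e r) = hhy (RbAfterEv⇒Hy e r)
      RbPAfterEvP⇒HyP c-id-ev   (pev e) rid         = hsu e
      RbPAfterEvP⇒HyP c-rb-ev   (pev e) (rrb r)     = hhy (RbAfterEv⇒Hy e r)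

    mutual
      Hy⇒RbAfterEv : ∀ {M N} → Hy la a1 a2 lh ah M N → RbAfterEv M N
      Hy⇒RbAfterEv hvar = _ , evar , rvar
      Hy⇒RbAfterEv (hlam h) with HyP⇒RbPAfterEvP la-eq h
      ... | _ , p , q = _ , elam p , rlam q
      Hy⇒RbAfterEv (hbeta e p h) with Hy⇒RbAfterEv h
      ... | _ , e′ , r = _ , ebeta e p e′ , r
      Hy⇒RbAfterEv (happ e nl h q) with Hy⇒RbAfterEv h | HyP⇒RbPAfterEvP ar-eq q
      ... | _ , e′ , r | _ , p , q′ with Ev-result-fixed e e′
      ... | refl = _ , eapp e nl p , rapp r q′

      HyP⇒RbPAfterEvP : ∀ {r x h M N} → CompEq r x h → HyP la a1 a2 lh ah h M N →
                        RbPAfterEvP r x M N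
      HyP⇒RbPAfterEvP c-id-id   hid     = _ , pid , rid
      HyP⇒RbPAfterEvP c-ev-id   (hsu e) = _ , pid , rev e
      HyP⇒RbPAfterEvP c-rbev-id (hhy h) with Hy⇒RbAfterEv h
      ... | _ , e , r = _ , pid , rrbev e r
      HyP⇒RbPAfterEvP c-id-ev   (hsu e) = _ , pev e , rid
      HyP⇒RbPAfterEvP c-rb-ev   (hhy h) with Hy⇒RbAfterEv h
      ... | _ , e , r = _ , pev e , rrb r

    RbAfterEv⇔Hy : ∀ {M N} → RbAfterEv M N ⇔ Hy la a1 a2 lh ah M N
    RbAfterEv⇔Hy = mk⇔ (λ { (_ , e , r) → RbAfterEv⇒Hy e r }) Hy⇒RbAfterEv

corollary8p2 : (lae ar1e ar2e : EP) (lar ar2r : RP)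
    (las ar1s ar2s : EP) (lah ar2h : HP) →
    RbProviso lae ar2e lar ar2r →
    HyProviso las ar2s lah ar2h →
    lae ≡ las → ar1e ≡ ar1s → ar2e ≡ ar2s →
    CompEq lar lae lah → CompEq ar2r ar2e ar2h →
    (M N : Term) →
    (Σ Term (λ P → Ev lae ar1e ar2e M P × Rb lae ar1e ar2e lar ar2r P N))
      ⇔ Hy las ar1s ar2s lah ar2h M N
corollary8p2 _ _ _ _ _ _ _ _ _ _ _ _ refl refl refl la-eq ar-eq _ _ =
  RbAfterEv⇔Hy la-eq ar-eq
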